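{- For every permutation $\pi$, the rev-tier $t_{\operatorname{rev}}(\pi)$ equals the maximum integer $t\ge 0$ for which there exist separated pairs $(i_1,i_1+1),(i_2,i_2+1),\ldots,(i_t,i_t+1)$ of $\pi$ with $i_1<i_2<\cdots<i_t$ whose orientations alternate (in this order), beginning with a down separated pair. (The maximum is $0$ when no such nonempty sequence exists.)
   Context: Sorting procedure (reverse-pass stack sorting): A permutation $\pi=\pi_1\cdots\pi_n$ of $\{1,\ldots,n\}$ is processed using an input sequence (initially $\pi_1,\ldots,\pi_n$), a stack (initially empty) and an output sequence (initially empty). Let $m$ denote the smallest value not yet output. At each step: if the stack is nonempty and its top entry equals $m$, pop it to the output; otherwise, if the input is nonempty, push the first entry of the input onto the stack. (So an entry leaves the stack only when it is the next entry of $1,2,\ldots,n$ needed in the output, and larger entries may be placed above smaller ones.) When no move is possible and the stack is still nonempty, the entries remaining in the stack are returned to the input in the reverse of their order in the previous input (equivalently, listed from the top of the stack to the bottom), and the procedure is repeated on them. Each run of the procedure is called a reverse pass. The rev-tier $t_{\operatorname{rev}}(\pi)$ is the number of times entries must be returned to the input before the output is $1,2,\ldots,n$. Separated pairs: for $\sigma\in S_n$ and $i\in\{1,\ldots,n-1\}$, $(i,i+1)$ is a separated pair of $\sigma$ if some entry $k>i+1$ lies (in position) between the entries $i$ and $i+1$ of $\sigma$. It is up separated (up oriented) if $i$ precedes $i+1$ in $\sigma$, and down separated otherwise. -}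

module Defs where

open import Data.Nat using (ℕ; zero; suc; _<_; _≤_; _≟_)
open import Data.List using (List; []; _∷_; length; lookup; map; upTo)
open import Data.Fin as Fin using (Fin)
open import Data.Product using (Σ; _×_; _,_; ∃; ∃-syntax)
open import Relation.Nullary using (yes; no; ¬_)
open import Relation.Binary.PropositionalEquality using (_≡_)
open import Data.List.Relation.Binary.Permutation.Propositional using (_↭_)
open import Data.List.Relation.Unary.Linked using (Linked)

-- Permutations of {1,…,n} in one-line notation, as lists.

IsPerm : ℕ → List ℕ → Set
IsPerm n π = π ↭ map suc (upTo n)

-- The stack is a list whose head is the top entry.
-- The state also records m = the smallest value not yet output
-- (the output itself is always 1,2,…,m-1, so it is determined by m).

popAll : ℕ → List ℕ → List ℕ × ℕ
popAll m [] = [] , m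
popAll m (x ∷ s) with x ≟ m
... | yes _ = popAll (suc m) s
... | no  _ = (x ∷ s) , m

-- process the input: push the next input entry, then pop while possible
-- (when the top differs from m, the only possible move is a push).
process : ℕ → List ℕ → List ℕ → List ℕ × ℕ
process m s [] = popAll m s
process m s (x ∷ inp) with popAll m (x ∷ s)
... | s' , m' = process m' s' inp

revPass : ℕ → List ℕ → List ℕ × ℕ
revPass m inp = process m [] inp

-- Tier m inp k : starting with input inp and m, entries are returned
-- to the input exactly k times before sorting finishes.  The returned
-- input is the stack listed from top to bottom, i.e. the list s itself.
data Tier : ℕ → List ℕ → ℕ → Set where
  finish : ∀ {m inp m'} → revPass m inp ≡ ([] , m') → Tier m inp 0
  return : ∀ {m inp s m' k} → revPass m inp ≡ (s , m') → ¬ (s ≡ []) →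
           Tier m' s k → Tier m inp (suc k)

RevTier : List ℕ → ℕ → Set
RevTier π t = Tier 1 π t

data Orientation : Set where
  up down : Orientation

flipO : Orientation → Orientation
flipO up = down
flipO down = up

UpSep : List ℕ → ℕ → Set
UpSep σ i = Σ (Fin (length σ)) λ p → Σ (Fin (length σ)) λ q → Σ (Fin (length σ)) λ r →
  lookup σ p ≡ i × lookup σ q ≡ suc i × p Fin.< r × r Fin.< q × suc i < lookup σ r

DownSep : List ℕ → ℕ → Set
DownSep σ i = Σ (Fin (length σ)) λ p → Σ (Fin (length σ)) λ q → Σ (Fin (length σ)) λ r →
  lookup σ p ≡ i × lookup σ q ≡ suc i × q Fin.< r × r Fin.< p × suc i < lookup σ r

Sep : Orientation → List ℕ → ℕ → Set
Sep up σ i = UpSep σ i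
Sep down σ i = DownSep σ i

data Alt (σ : List ℕ) : Orientation → List ℕ → Set where
  []  : ∀ {o} → Alt σ o []
  _∷_ : ∀ {o i is} → Sep o σ i → Alt σ (flipO o) is → Alt σ o (i ∷ is)

AltSeq : List ℕ → List ℕ → Set
AltSeq σ is = Linked _<_ is × Alt σ down is

MaxAlt : List ℕ → ℕ → Set
MaxAlt σ t = (∃[ is ] (AltSeq σ is × length is ≡ t)) ×
             (∀ is → AltSeq σ is → length is ≤ t)

module Submission where

-- We work with a "segment": a list σ of the integers m, m+1, …
-- (each once, in any order).  A single reverse pass started at m outputs
-- m, m+1, …, m'-1 and stops at the first target m' that is still buried in
-- the stack; it leaves the entries ≥ m' on the stack in reverse reading order,
-- so the next input is  rest m' σ = reverse (entries of σ that are ≥ m').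
-- The pass stops at m' exactly because (m'-1, m') is down separated, and no
-- earlier pair (i, i+1) with i+1 < m' is down separated.  Reversal swaps the
-- orientation of every separated pair among the entries ≥ m', so a maximal
-- alternating sequence for σ is the pair (m'-1, m') followed by a maximal
-- alternating sequence for rest m' σ.  Both quantities therefore grow by one
-- per pass, and induction on the length of σ gives the theorem.

open import Defs
open import Data.Nat using (ℕ; suc; _<_; _≤_; _≟_; _≤?_; z≤n; s≤s)
open import Data.Nat.Properties
  using (≤-refl; ≤-trans; <-trans; <⇒≤; <⇒≱; ≤∧≢⇒<; ≮⇒≥; n≤1+n; n≮n; 1+n≢n; ≤-<-trans; ≤-pred; suc-injective; m≤n⇒m<n∨m≡n)
open import Data.Nat.Induction using (<-wellFounded)
open import Induction.WellFounded using (Acc; acc)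
open import Data.List using (List; []; _∷_; _++_; length; lookup; filter; reverse)
open import Data.List.Properties
  using (filter-++; filter-all; filter-accept; filter-reject; filter-none; filter-notAll; reverse-++; unfold-reverse; reverse-involutive; length-reverse; ++-identityʳ; ++-assoc)
open import Data.List.Membership.Propositional using (_∈_; find; lose)
open import Data.List.Membership.Propositional.Properties using (∈-lookup; ∈-++⁻; ∈-filter⁻; ∈-filter⁺; ∈-map⁻; ∈-map⁺; ∈-upTo⁺; ∈-upTo⁻)
open import Data.List.Relation.Unary.Any as Any using (Any; here; there; any?)
open import Data.List.Relation.Unary.Any.Properties using () renaming (reverse⁺ to ∈-reverse⁺; reverse⁻ to ∈-reverse⁻)
open import Data.List.Relation.Unary.All as All using (All; []; _∷_)
open import Data.List.Relation.Unary.All.Properties using (¬Any⇒All¬)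
open import Data.List.Relation.Unary.Linked as Linked using (Linked; []; [-]; _∷_)
open import Data.List.Relation.Unary.Linked.Properties using (Linked⇒All)
open import Data.List.Relation.Unary.Unique.Propositional using (Unique)
open import Data.List.Relation.Unary.AllPairs using (_∷_)
open import Data.List.Relation.Unary.Unique.Propositional.Properties using () renaming (map⁺ to unique-map⁺; upTo⁺ to unique-upTo⁺)
open import Data.List.Relation.Binary.Sublist.Propositional using (_⊆_; []; _∷_; _∷ʳ_; ⊆-refl; ⊆-trans; from∈; to∈)
open import Data.List.Relation.Binary.Sublist.Propositional.Properties
  using (∷ˡ⁻; ++⁺; ++⁺ʳ; filter-⊆; filter⁺) renaming (reverse⁺ to ⊆-reverse⁺)
open import Data.List.Relation.Binary.Permutation.Propositional using (↭-sym; ↭⇒↭ₛ)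
open import Data.List.Relation.Binary.Permutation.Propositional.Properties using (∈-resp-↭)
open import Data.Fin as Fin using (Fin)
open import Data.Product using (Σ; _×_; _,_; proj₁; proj₂; ∃-syntax)
open import Data.Sum using (inj₁; inj₂)
open import Data.Unit using (⊤; tt)
open import Data.Empty using (⊥; ⊥-elim)
open import Function using (_∘_)
open import Relation.Nullary using (¬_; Dec; yes; no)
open import Relation.Binary.PropositionalEquality
open import Data.List.Relation.Binary.Permutation.Setoid.Properties (setoid ℕ) using (Unique-resp-↭)

private
  variable
    a b i k m m′ v x : ℕ
    o : Orientation
    c inp st xs ys zs σ τ : List ℕ

-- No value occurs twice; phrased via subsequences, which is how it is used.
Distinct : List ℕ → Set
Distinct xs = ∀ x → ¬ (x ∷ x ∷ []) ⊆ xs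

distinct-⊆ : xs ⊆ ys → Distinct ys → Distinct xs
distinct-⊆ xs⊆ys d x xx⊆xs = d x (⊆-trans xx⊆xs xs⊆ys)

distinct-reverse : Distinct xs → Distinct (reverse xs)
distinct-reverse {xs} d x xx⊆ = d x (subst (_ ⊆_) (reverse-involutive xs) (⊆-reverse⁺ xx⊆))

order-unique : Distinct zs → (a ∷ b ∷ []) ⊆ zs → (b ∷ a ∷ []) ⊆ zs → ⊥
order-unique {z ∷ zs} d (_ ∷ʳ p) (_ ∷ʳ q) = order-unique (distinct-⊆ (z ∷ʳ ⊆-refl) d) p q
order-unique {z ∷ zs} d (refl ∷ p) (_ ∷ʳ q) = d z (refl ∷ ∷ˡ⁻ q)
order-unique {z ∷ zs} d (_ ∷ʳ p) (refl ∷ q) = d z (refl ∷ ∷ˡ⁻ p)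
order-unique {z ∷ zs} d (refl ∷ p) (refl ∷ q) = d z (refl ∷ q)

disjoint-++ : Distinct (xs ++ ys) → x ∈ xs → x ∈ ys → ⊥
disjoint-++ d x∈xs x∈ys = d _ (++⁺ (from∈ x∈xs) (from∈ x∈ys))

precedes-prefix : Distinct (c ++ inp) → (a ∷ b ∷ []) ⊆ c ++ inp → b ∈ c → a ∈ c
precedes-prefix {c} d ab b∈c with ∈-++⁻ c (to∈ ab)
... | inj₁ a∈c = a∈c
... | inj₂ a∈inp = ⊥-elim (order-unique d ab (++⁺ (from∈ b∈c) (from∈ a∈inp)))

unique⇒distinct : Unique xs → Distinct xs
unique⇒distinct (_ ∷ u) x (_ ∷ʳ p) = unique⇒distinct u x p
unique⇒distinct (x≢ ∷ _) x (refl ∷ p) = All.lookup x≢ (to∈ p) refl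

atLeast : ℕ → List ℕ → List ℕ
atLeast m = filter (m ≤?_)

atLeast-⊆ : ∀ m xs → atLeast m xs ⊆ xs
atLeast-⊆ m = filter-⊆ (m ≤?_)

∈-atLeast⁻ : x ∈ atLeast m xs → x ∈ xs × m ≤ x
∈-atLeast⁻ {m = m} = ∈-filter⁻ (m ≤?_)

∈-atLeast⁺ : x ∈ xs → m ≤ x → x ∈ atLeast m xs
∈-atLeast⁺ {m = m} = ∈-filter⁺ (m ≤?_)

⊆-atLeast : All (m ≤_) xs → xs ⊆ ys → xs ⊆ atLeast m ys
⊆-atLeast {m} {ys = ys} all≥ p = subst (_⊆ atLeast m ys) (filter-all (m ≤?_) all≥) (filter⁺ (m ≤?_) (m ≤?_) (λ { refl q → q }) p)

atLeast-∷ : ∀ m x → atLeast m ys ≡ atLeast m zs → atLeast m (x ∷ ys) ≡ atLeast m (x ∷ zs)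
atLeast-∷ m x e with m ≤? x
... | yes m≤x = trans (filter-accept (m ≤?_) m≤x) (trans (cong (x ∷_) e) (sym (filter-accept (m ≤?_) m≤x)))
... | no m≰x = trans (filter-reject (m ≤?_) m≰x) (trans e (sym (filter-reject (m ≤?_) m≰x)))

atLeast-atLeast : a ≤ b → ∀ xs → atLeast b (atLeast a xs) ≡ atLeast b xs
atLeast-atLeast a≤b [] = refl
atLeast-atLeast {a} {b} a≤b (x ∷ xs) with a ≤? x
... | yes a≤x = trans (cong (atLeast b) (filter-accept (a ≤?_) a≤x)) (atLeast-∷ b x (atLeast-atLeast a≤b xs))
... | no a≰x = begin
  atLeast b (atLeast a (x ∷ xs)) ≡⟨ cong (atLeast b) (filter-reject (a ≤?_) a≰x) ⟩
  atLeast b (atLeast a xs)       ≡⟨ atLeast-atLeast a≤b xs ⟩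
  atLeast b xs                   ≡⟨ filter-reject (b ≤?_) (a≰x ∘ ≤-trans a≤b) ⟨
  atLeast b (x ∷ xs)             ∎
  where open ≡-Reasoning

atLeast-reverse : ∀ m xs → atLeast m (reverse xs) ≡ reverse (atLeast m xs)
atLeast-reverse m [] = refl
atLeast-reverse m (x ∷ xs) with m ≤? x
... | yes m≤x = begin
  atLeast m (reverse (x ∷ xs))                 ≡⟨ cong (atLeast m) (unfold-reverse x xs) ⟩
  atLeast m (reverse xs ++ x ∷ [])             ≡⟨ filter-++ (m ≤?_) (reverse xs) (x ∷ []) ⟩
  atLeast m (reverse xs) ++ atLeast m (x ∷ []) ≡⟨ cong₂ _++_ (atLeast-reverse m xs) (filter-accept (m ≤?_) m≤x) ⟩
  reverse (atLeast m xs) ++ x ∷ []             ≡⟨ reverse-++ (x ∷ []) (atLeast m xs) ⟨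
  reverse (x ∷ atLeast m xs)                   ≡⟨ cong reverse (filter-accept (m ≤?_) m≤x) ⟨
  reverse (atLeast m (x ∷ xs))                 ∎
  where open ≡-Reasoning
... | no m≰x = begin
  atLeast m (reverse (x ∷ xs))                 ≡⟨ cong (atLeast m) (unfold-reverse x xs) ⟩
  atLeast m (reverse xs ++ x ∷ [])             ≡⟨ filter-++ (m ≤?_) (reverse xs) (x ∷ []) ⟩
  atLeast m (reverse xs) ++ atLeast m (x ∷ []) ≡⟨ cong₂ _++_ (atLeast-reverse m xs) (filter-reject (m ≤?_) m≰x) ⟩
  reverse (atLeast m xs) ++ []                 ≡⟨ ++-identityʳ _ ⟩
  reverse (atLeast m xs)                       ≡⟨ cong reverse (filter-reject (m ≤?_) m≰x) ⟨
  reverse (atLeast m (x ∷ xs))                 ∎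
  where open ≡-Reasoning

-- rest m σ : the input of the next pass when the current pass stops at target m.
rest : ℕ → List ℕ → List ℕ
rest m σ = reverse (atLeast m σ)

∈-rest⁻ : ∀ σ → x ∈ rest m σ → x ∈ σ × m ≤ x
∈-rest⁻ σ = ∈-atLeast⁻ ∘ ∈-reverse⁻

∈-rest⁺ : x ∈ σ → m ≤ x → x ∈ rest m σ
∈-rest⁺ x∈σ m≤x = ∈-reverse⁺ (∈-atLeast⁺ x∈σ m≤x)

rest-order : xs ⊆ rest m σ → reverse xs ⊆ σ
rest-order {m = m} {σ} p = ⊆-trans (subst (_ ⊆_) (reverse-involutive _) (⊆-reverse⁺ p)) (atLeast-⊆ m σ)

-- Separated pairs as subsequence patterns

-- The reading order witnessing a separated pair (i, i+1) with separator k.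
shape : Orientation → ℕ → ℕ → List ℕ
shape up i k = i ∷ k ∷ suc i ∷ []
shape down i k = suc i ∷ k ∷ i ∷ []

reverse-shape : ∀ o i k → reverse (shape o i k) ≡ shape (flipO o) i k
reverse-shape up i k = refl
reverse-shape down i k = refl

shape-atLeast : ∀ o → m ≤ i → suc i < k → All (m ≤_) (shape o i k)
shape-atLeast {m} {i} up m≤i i+1<k = m≤i ∷ ≤-trans m≤i (≤-trans (n≤1+n i) (<⇒≤ i+1<k)) ∷ ≤-trans m≤i (n≤1+n i) ∷ []
shape-atLeast {m} {i} down m≤i i+1<k = ≤-trans m≤i (n≤1+n i) ∷ ≤-trans m≤i (≤-trans (n≤1+n i) (<⇒≤ i+1<k)) ∷ m≤i ∷ []

SepSub : Orientation → List ℕ → ℕ → Set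
SepSub o σ i = ∃[ k ] suc i < k × shape o i k ⊆ σ

Down : List ℕ → ℕ → Set
Down = SepSub down

sepSub-⊆ : σ ⊆ τ → SepSub o σ i → SepSub o τ i
sepSub-⊆ σ⊆τ (k , lt , p) = k , lt , ⊆-trans p σ⊆τ

sepSub-ends : ∀ o → SepSub o σ i → i ∈ σ × suc i ∈ σ
sepSub-ends up (k , _ , p) = to∈ p , to∈ (∷ˡ⁻ (∷ˡ⁻ p))
sepSub-ends down (k , _ , p) = to∈ (∷ˡ⁻ (∷ˡ⁻ p)) , to∈ p

sepSub-reverse : SepSub o σ i → SepSub (flipO o) (reverse σ) i
sepSub-reverse {o} {i = i} (k , lt , p) = k , lt , subst (_⊆ _) (reverse-shape o i k) (⊆-reverse⁺ p)

sepSub-atLeast : m ≤ i → SepSub o σ i → SepSub o (atLeast m σ) i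
sepSub-atLeast {o = o} m≤i (k , lt , p) = k , lt , ⊆-atLeast (shape-atLeast o m≤i lt) p

lookup₂-⊆ : (σ : List ℕ) (r q : Fin (length σ)) → r Fin.< q → lookup σ r ∷ lookup σ q ∷ [] ⊆ σ
lookup₂-⊆ (x ∷ σ) Fin.zero (Fin.suc q) _ = refl ∷ from∈ (∈-lookup q)
lookup₂-⊆ (x ∷ σ) (Fin.suc r) (Fin.suc q) (s≤s r<q) = x ∷ʳ lookup₂-⊆ σ r q r<q

lookup₃-⊆ : (σ : List ℕ) (p r q : Fin (length σ)) → p Fin.< r → r Fin.< q →
            lookup σ p ∷ lookup σ r ∷ lookup σ q ∷ [] ⊆ σ
lookup₃-⊆ (x ∷ σ) Fin.zero (Fin.suc r) (Fin.suc q) _ (s≤s r<q) = refl ∷ lookup₂-⊆ σ r q r<q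
lookup₃-⊆ (x ∷ σ) (Fin.suc p) (Fin.suc r) (Fin.suc q) (s≤s p<r) (s≤s r<q) = x ∷ʳ lookup₃-⊆ σ p r q p<r r<q

⊆-lookup₁ : a ∷ [] ⊆ σ → Σ (Fin (length σ)) λ p → lookup σ p ≡ a
⊆-lookup₁ (_ ∷ʳ s) with ⊆-lookup₁ s
... | p , e = Fin.suc p , e
⊆-lookup₁ (refl ∷ _) = Fin.zero , refl

⊆-lookup₂ : a ∷ b ∷ [] ⊆ σ → Σ (Fin (length σ)) λ p → Σ (Fin (length σ)) λ q →
            p Fin.< q × lookup σ p ≡ a × lookup σ q ≡ b
⊆-lookup₂ (_ ∷ʳ s) with ⊆-lookup₂ s
... | p , q , p<q , ea , eb = Fin.suc p , Fin.suc q , s≤s p<q , ea , eb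
⊆-lookup₂ (refl ∷ s) with ⊆-lookup₁ s
... | q , eb = Fin.zero , Fin.suc q , s≤s z≤n , refl , eb

⊆-lookup₃ : a ∷ b ∷ x ∷ [] ⊆ σ → Σ (Fin (length σ)) λ p → Σ (Fin (length σ)) λ r → Σ (Fin (length σ)) λ q →
            p Fin.< r × r Fin.< q × lookup σ p ≡ a × lookup σ r ≡ b × lookup σ q ≡ x
⊆-lookup₃ (_ ∷ʳ s) with ⊆-lookup₃ s
... | p , r , q , p<r , r<q , ea , eb , ex = Fin.suc p , Fin.suc r , Fin.suc q , s≤s p<r , s≤s r<q , ea , eb , ex
⊆-lookup₃ (refl ∷ s) with ⊆-lookup₂ s
... | r , q , r<q , eb , ex = Fin.zero , Fin.suc r , Fin.suc q , s≤s z≤n , s≤s r<q , refl , eb , ex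

sep⇒sepSub : ∀ o → Sep o σ i → SepSub o σ i
sep⇒sepSub {σ} up (p , q , r , refl , ei+1 , p<r , r<q , lt) =
  lookup σ r , lt , subst (λ z → lookup σ p ∷ lookup σ r ∷ z ∷ [] ⊆ σ) ei+1 (lookup₃-⊆ σ p r q p<r r<q)
sep⇒sepSub {σ} down (p , q , r , refl , ei+1 , q<r , r<p , lt) =
  lookup σ r , lt , subst (λ z → z ∷ lookup σ r ∷ lookup σ p ∷ [] ⊆ σ) ei+1 (lookup₃-⊆ σ q r p q<r r<p)

sepSub⇒sep : ∀ o → SepSub o σ i → Sep o σ i
sepSub⇒sep up (k , lt , s) with ⊆-lookup₃ s
... | p , r , q , p<r , r<q , ei , ek , ei+1 = p , q , r , ei , ei+1 , p<r , r<q , subst (_ <_) (sym ek) lt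
sepSub⇒sep down (k , lt , s) with ⊆-lookup₃ s
... | q , r , p , q<r , r<p , ei+1 , ek , ei = p , q , r , ei , ei+1 , q<r , r<p , subst (_ <_) (sym ek) lt

sepSub-fromRest : SepSub o (rest m σ) i → SepSub (flipO o) σ i
sepSub-fromRest {o} {m} {σ} {i} (k , lt , p) = k , lt , subst (_⊆ σ) (reverse-shape o i k) (rest-order {m = m} {σ} p)

sep-fromRest : Sep o (rest m σ) i → Sep (flipO o) σ i
sep-fromRest {o} {m} {σ} = sepSub⇒sep (flipO o) ∘ sepSub-fromRest {m = m} {σ} ∘ sep⇒sepSub o

sep-toRest : m ≤ i → Sep o σ i → Sep (flipO o) (rest m σ) i
sep-toRest {o = o} m≤i s = sepSub⇒sep (flipO o) (sepSub-reverse (sepSub-atLeast m≤i (sep⇒sepSub o s)))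

sep-ends : ∀ o → Sep o σ i → i ∈ σ × suc i ∈ σ
sep-ends o = sepSub-ends o ∘ sep⇒sepSub o

-- One reverse pass

Stable : ℕ → List ℕ → Set
Stable m [] = ⊤
Stable m (x ∷ _) = x ≢ m

stable-popAll : Stable m st → popAll m st ≡ (st , m)
stable-popAll {st = []} _ = refl
stable-popAll {m} {x ∷ st} x≢m with x ≟ m
... | yes x≡m = ⊥-elim (x≢m x≡m)
... | no _ = refl

record Outcome (m₀ : ℕ) (σ : List ℕ) (result : List ℕ × ℕ) : Set where
  field
    next          : ℕ
    result≡       : result ≡ (rest next σ , next)
    start≤next    : m₀ ≤ next
    clearBelow    : ∀ i → suc i < next → ¬ Down σ i
    blockedAtNext : next ∈ σ → ∃[ i ] next ≡ suc i × Down σ i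

stack-after-pop : ∀ c → v ∷ st ≡ reverse (atLeast v c) → All (suc v ≤_) st → st ≡ reverse (atLeast (suc v) c)
stack-after-pop {v} {st} c stack above = sym (begin
  reverse (atLeast (suc v) c)                  ≡⟨ cong reverse (atLeast-atLeast (n≤1+n v) c) ⟨
  reverse (atLeast (suc v) (atLeast v c))      ≡⟨ atLeast-reverse (suc v) (atLeast v c) ⟨
  atLeast (suc v) (reverse (atLeast v c))      ≡⟨ cong (atLeast (suc v)) stack ⟨
  atLeast (suc v) (v ∷ st)                     ≡⟨ filter-reject (suc v ≤?_) (n≮n v) ⟩
  atLeast (suc v) st                           ≡⟨ filter-all (suc v ≤?_) above ⟩
  st                                           ∎)
  where open ≡-Reasoning

module Pass {σ : List ℕ} (distinct : Distinct σ) (m₀ : ℕ) where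

  record Invariant (c inp : List ℕ) (m : ℕ) (st : List ℕ) : Set where
    field
      split      : c ++ inp ≡ σ
      stack      : st ≡ reverse (atLeast m c)
      pending    : All (m ≤_) inp
      start≤     : m₀ ≤ m
      clearBelow : ∀ i → suc i < m → ¬ Down σ i
      blocked    : Stable m st → m ∈ c → ∃[ i ] m ≡ suc i × Down c i

  module State (I : Invariant c inp m st) where
    open Invariant I

    distinct-split : Distinct (c ++ inp)
    distinct-split = subst Distinct (sym split) distinct

    prefix-⊆ : c ⊆ σ
    prefix-⊆ = subst (c ⊆_) split (++⁺ʳ inp ⊆-refl)

    stack-∈ : x ∈ st → x ∈ c × m ≤ x
    stack-∈ x∈st = ∈-rest⁻ c (subst (_ ∈_) stack x∈st)

    ∈-stack : x ∈ c → m ≤ x → x ∈ st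
    ∈-stack x∈c m≤x = subst (_ ∈_) (sym stack) (∈-rest⁺ x∈c m≤x)

    stack-order : xs ⊆ st → reverse xs ⊆ c
    stack-order p = rest-order (subst (_ ⊆_) stack p)

    stack-distinct : Distinct st
    stack-distinct = subst Distinct (sym stack) (distinct-reverse (distinct-⊆ (⊆-trans (atLeast-⊆ m c) prefix-⊆) distinct))

  above-top : Invariant c inp v (v ∷ st) → All (suc v ≤_) st
  above-top I = All.tabulate λ x∈st →
    ≤∧≢⇒< (proj₂ (stack-∈ (there x∈st))) (λ { refl → stack-distinct _ (refl ∷ from∈ x∈st) })
    where open State I

  -- When v = suc i is popped, (i, suc i) is not down separated: in a reading
  -- order suc i, k, i the entry i is already read (it is below the target),
  -- hence so is k, and k > suc i would sit above suc i on the stack.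
  clear-at-pop : Invariant c inp (suc i) (suc i ∷ st) → ¬ Down σ i
  clear-at-pop {c} {inp} {i} {st} I (k , i+1<k , p) =
    order-unique distinct (⊆-trans (refl ∷ refl ∷ i ∷ʳ []) p) k-before-i+1
    where
      open Invariant I
      open State I
      p′ : shape down i k ⊆ c ++ inp
      p′ = subst (shape down i k ⊆_) (sym split) p
      i∈c : i ∈ c
      i∈c with ∈-++⁻ c (to∈ (∷ˡ⁻ (∷ˡ⁻ p′)))
      ... | inj₁ i∈c = i∈c
      ... | inj₂ i∈inp = ⊥-elim (n≮n i (All.lookup pending i∈inp))
      k∈st : k ∈ st
      k∈st with ∈-stack (precedes-prefix distinct-split (∷ˡ⁻ p′) i∈c) (<⇒≤ i+1<k)
      ... | here refl = ⊥-elim (n≮n _ i+1<k)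
      ... | there k∈st = k∈st
      k-before-i+1 : k ∷ suc i ∷ [] ⊆ σ
      k-before-i+1 = ⊆-trans (stack-order (refl ∷ from∈ k∈st)) prefix-⊆

  -- After popping v, a read but buried new target suc v lies below the new top k;
  -- then k > suc v and the reading order suc v, k, v shows Down c v.
  blocked-after-pop : Invariant c inp v (v ∷ st) → Stable (suc v) st → suc v ∈ c → Down c v
  blocked-after-pop {v = v} {st = []} I _ v+1∈c with State.∈-stack I v+1∈c (n≤1+n v)
  ... | here v+1≡v = ⊥-elim (1+n≢n v+1≡v)
  blocked-after-pop {v = v} {st = k ∷ st} I k≢v+1 v+1∈c with State.∈-stack I v+1∈c (n≤1+n v)
  ... | here v+1≡v = ⊥-elim (1+n≢n v+1≡v)
  ... | there (here v+1≡k) = ⊥-elim (k≢v+1 (sym v+1≡k))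
  ... | there (there v+1∈st) =
    k , ≤∧≢⇒< (All.head (above-top I)) (k≢v+1 ∘ sym) , State.stack-order I (refl ∷ refl ∷ from∈ v+1∈st)

  pop : Invariant c inp v (v ∷ st) → Invariant c inp (suc v) st
  pop {c} {inp} {v} {st} I = record
    { split      = split
    ; stack      = stack-after-pop c stack (above-top I)
    ; pending    = All.tabulate λ x∈inp →
                     ≤∧≢⇒< (All.lookup pending x∈inp) (λ { refl → disjoint-++ distinct-split v∈c x∈inp })
    ; start≤     = ≤-trans start≤ (n≤1+n v)
    ; clearBelow = clearBelow′
    ; blocked    = λ stable v+1∈c → v , refl , blocked-after-pop I stable v+1∈c
    }
    where
      open Invariant I
      open State I
      v∈c : v ∈ c
      v∈c = proj₁ (stack-∈ (here refl))
      clearBelow′ : ∀ i → suc i < suc v → ¬ Down σ i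
      clearBelow′ i i+1≤v with m≤n⇒m<n∨m≡n (≤-pred i+1≤v)
      ... | inj₁ i+1<v = clearBelow i i+1<v
      ... | inj₂ refl = clear-at-pop I

  -- Reading x (which is ≥ m since it has not been output) pushes it on the stack.
  push : Invariant c (x ∷ inp) m st → Stable m st → Invariant (c ++ x ∷ []) inp m (x ∷ st)
  push {c} {x} {inp} {m} {st} I stable = record
    { split      = trans (++-assoc c (x ∷ []) inp) split
    ; stack      = sym stack′
    ; pending    = All.tail pending
    ; start≤     = start≤
    ; clearBelow = clearBelow
    ; blocked    = blocked′
    }
    where
      open Invariant I
      open ≡-Reasoning
      stack′ : reverse (atLeast m (c ++ x ∷ [])) ≡ x ∷ st
      stack′ = begin
        reverse (atLeast m (c ++ x ∷ []))          ≡⟨ cong reverse (filter-++ (m ≤?_) c (x ∷ [])) ⟩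
        reverse (atLeast m c ++ atLeast m (x ∷ [])) ≡⟨ cong (λ z → reverse (atLeast m c ++ z)) (filter-accept (m ≤?_) (All.head pending)) ⟩
        reverse (atLeast m c ++ x ∷ [])            ≡⟨ reverse-++ (atLeast m c) (x ∷ []) ⟩
        x ∷ reverse (atLeast m c)                  ≡⟨ cong (x ∷_) stack ⟨
        x ∷ st                                     ∎
      blocked′ : Stable m (x ∷ st) → m ∈ c ++ x ∷ [] → ∃[ i ] m ≡ suc i × Down (c ++ x ∷ []) i
      blocked′ x≢m m∈ with ∈-++⁻ c m∈
      ... | inj₂ (here m≡x) = ⊥-elim (x≢m (sym m≡x))
      ... | inj₁ m∈c with blocked stable m∈c
      ...   | i , m≡i+1 , d = i , m≡i+1 , sepSub-⊆ {o = down} (++⁺ʳ (x ∷ []) ⊆-refl) d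

  Settled : List ℕ → List ℕ → List ℕ × ℕ → Set
  Settled c inp (st , m) = Invariant c inp m st × Stable m st

  popAll-settles : Invariant c inp m st → Settled c inp (popAll m st)
  popAll-settles {st = []} I = I , tt
  popAll-settles {m = m} {st = y ∷ st} I with y ≟ m
  ... | yes refl = popAll-settles (pop I)
  ... | no y≢m = I , y≢m

  run : Invariant c inp m st → Stable m st → Outcome m₀ σ (process m st inp)
  run {c} {[]} {m} {st} I stable = record
    { next          = m
    ; result≡       = trans (stable-popAll stable) (cong (_, m) (trans stack (cong (rest m) c≡σ)))
    ; start≤next    = start≤
    ; clearBelow    = clearBelow
    ; blockedAtNext = λ m∈σ → subst (λ τ → ∃[ i ] m ≡ suc i × Down τ i) c≡σ
                                    (blocked stable (subst (m ∈_) (sym c≡σ) m∈σ))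
    }
    where
      open Invariant I
      c≡σ : c ≡ σ
      c≡σ = trans (sym (++-identityʳ c)) split
  run {c} {x ∷ inp} {m} {st} I stable =
    let I′ , stable′ = popAll-settles (push I stable) in run I′ stable′

  pass : All (m₀ ≤_) σ → Outcome m₀ σ (revPass m₀ σ)
  pass bounded = run initial tt
    where
      initial : Invariant [] σ m₀ []
      initial = record
        { split      = refl
        ; stack      = refl
        ; pending    = bounded
        ; start≤     = ≤-refl
        ; clearBelow = λ i i+1<m₀ d →
            <⇒≱ (≤-<-trans (n≤1+n i) i+1<m₀) (All.lookup bounded (proj₁ (sepSub-ends down d)))
        ; blocked    = λ _ ()
        }

-- The maximal alternating length

alt-flip : {P : ℕ → Set} → (∀ {o i} → P i → Sep o σ i → Sep (flipO o) τ i) →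
           ∀ {o is} → All P is → Alt σ o is → Alt τ (flipO o) is
alt-flip f [] [] = []
alt-flip f (pi ∷ ps) (s ∷ alt) = f pi s ∷ alt-flip f ps alt

linked-above : ∀ {is} → Linked _<_ (i ∷ is) → All (i <_) is
linked-above [-] = []
linked-above (i<j ∷ linked) = Linked⇒All <-trans i<j linked

maxAlt-zero : (∀ i → ¬ Sep down σ i) → MaxAlt σ 0
maxAlt-zero {σ} noDown = ([] , ([] , []) , refl) , bound
  where
    bound : ∀ is → AltSeq σ is → length is ≤ 0
    bound [] _ = z≤n
    bound (i ∷ _) (_ , d ∷ _) = ⊥-elim (noDown i d)

maxAlt-step : ∀ {i₀ t} → suc i₀ ≡ m → Sep down σ i₀ → (∀ i → Sep down σ i → m ≤ suc i) →
              MaxAlt (rest m σ) t → MaxAlt σ (suc t)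
maxAlt-step {m} {σ} {i₀} {t} refl d₀ firstDown ((is , (linked , alt) , len) , bound) =
  (i₀ ∷ is , (linked′ is linked alt , d₀ ∷ alt-flip (λ _ → sep-fromRest) (All.universal (λ _ → tt) is) alt) , cong suc len) , bound′
  where
    linked′ : ∀ is → Linked _<_ is → Alt (rest m σ) down is → Linked _<_ (i₀ ∷ is)
    linked′ [] _ _ = [-]
    linked′ (j ∷ _) linked (d ∷ _) = proj₂ (∈-rest⁻ σ (proj₁ (sep-ends down d))) ∷ linked
    bound′ : ∀ is → AltSeq σ is → length is ≤ suc t
    bound′ [] _ = z≤n
    bound′ (i ∷ is) (linked , d ∷ alt) =
      s≤s (bound is (Linked.tail linked , alt-flip sep-toRest above alt))
      where
        above : All (m ≤_) is
        above = All.map (λ i<j → ≤-trans (firstDown i d) i<j) (linked-above linked)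

-- Segments and the induction

record Segment (m : ℕ) (σ : List ℕ) : Set where
  field
    distinct : Distinct σ
    bounded  : All (m ≤_) σ
    closed   : ∀ {u v} → v ∈ σ → m ≤ u → u ≤ v → u ∈ σ

segment-rest : Segment m σ → m ≤ m′ → Segment m′ (rest m′ σ)
segment-rest {m} {σ} {m′} seg m≤m′ = record
  { distinct = distinct-reverse (distinct-⊆ (atLeast-⊆ m′ σ) distinct)
  ; bounded  = All.tabulate (proj₂ ∘ ∈-rest⁻ σ)
  ; closed   = λ v∈ m′≤u u≤v → ∈-rest⁺ (closed (proj₁ (∈-rest⁻ σ v∈)) (≤-trans m≤m′ m′≤u) u≤v) m′≤u
  }
  where open Segment seg

rest-shorter : m ∈ σ → m < m′ → length (rest m′ σ) < length σ
rest-shorter {m} {σ} {m′} m∈σ m<m′ =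
  subst (_< length σ) (sym (length-reverse (atLeast m′ σ)))
        (filter-notAll (m′ ≤?_) σ (lose m∈σ (<⇒≱ m<m′)))

tier-maxAlt : ∀ m σ → Acc _<_ (length σ) → Segment m σ → ∃[ t ] Tier m σ t × MaxAlt σ t
tier-maxAlt m σ (acc smaller) seg = byRest (any? (next ≤?_) σ)
  where
    open Segment seg
    open Outcome (Pass.pass distinct m bounded)
    firstDown : ∀ i → Sep down σ i → next ≤ suc i
    firstDown i d = ≮⇒≥ (λ i+1<next → clearBelow i i+1<next (sep⇒sepSub down d))
    byRest : Dec (Any (next ≤_) σ) → ∃[ t ] Tier m σ t × MaxAlt σ t
    -- nothing is left: the pass sorts σ, and σ has no down separated pair
    byRest (no none) =
      0 , finish (trans result≡ (cong (λ z → reverse z , next) nothingLeft)) ,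
      maxAlt-zero (λ i d → none (lose (proj₂ (sep-ends down d)) (firstDown i d)))
      where
        nothingLeft : atLeast next σ ≡ []
        nothingLeft = filter-none (next ≤?_) (¬Any⇒All¬ σ none)
    -- some y ≥ next is left: next is blocked by a down pair (i₀, next), and we recurse
    byRest (yes some) with find some
    ... | y , y∈σ , next≤y with blockedAtNext (closed y∈σ start≤next next≤y)
    ...   | i₀ , next≡ , d₀ =
      let t , tier , maxAlt = tier-maxAlt next (rest next σ) (smaller shorter) (segment-rest seg start≤next)
      in suc t , return result≡ nonEmpty tier , maxAlt-step (sym next≡) (sepSub⇒sep down d₀) firstDown maxAlt
      where
        shorter : length (rest next σ) < length σ
        shorter = rest-shorter (closed y∈σ ≤-refl (All.lookup bounded y∈σ))
                               (subst (m <_) (sym next≡) (s≤s (All.lookup bounded (proj₁ (sepSub-ends down d₀)))))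
        nonEmpty : ¬ rest next σ ≡ []
        nonEmpty empty with subst (y ∈_) empty (∈-rest⁺ y∈σ next≤y)
        ... | ()

perm-segment : ∀ n π → IsPerm n π → Segment 1 π
perm-segment n π π↭ = record
  { distinct = unique⇒distinct (Unique-resp-↭ (↭⇒↭ₛ (↭-sym π↭)) (unique-map⁺ suc-injective (unique-upTo⁺ n)))
  ; bounded  = All.tabulate positive
  ; closed   = closed
  }
  where
    positive : v ∈ π → 1 ≤ v
    positive v∈π with ∈-map⁻ suc (∈-resp-↭ π↭ v∈π)
    ... | _ , _ , refl = s≤s z≤n
    closed : ∀ {u v} → v ∈ π → 1 ≤ u → u ≤ v → u ∈ π
    closed {suc u} v∈π _ u≤v with ∈-map⁻ suc (∈-resp-↭ π↭ v∈π)
    ... | w , w∈ , refl = ∈-resp-↭ (↭-sym π↭) (∈-map⁺ suc (∈-upTo⁺ (≤-<-trans (≤-pred u≤v) (∈-upTo⁻ w∈))))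

mainTheorem1 : (n : ℕ) (π : List ℕ) → IsPerm n π →
    Σ ℕ (λ t → RevTier π t × MaxAlt π t)
mainTheorem1 n π π↭ = tier-maxAlt 1 π (<-wellFounded (length π)) (perm-segment n π π↭)
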